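{- Let $H=(\mathcal{V},\mathcal{E})$ be a hypergraph. Let $\chi_{min}(H)=\min_t \chi(\Gamma_t)$, the minimum chromatic number over all co-occurrence graphs $\Gamma_t$ of $H$, where $t$ ranges over all functions $t:\mathcal{E}\to\mathcal{V}$ with $t(e)\in e$ for every $e\in\mathcal{E}$. Then $\chi_{cf}(H)=\chi_{min}(H)$.
   Context: A hypergraph $H=(\mathcal{V},\mathcal{E})$ has a finite vertex set $\mathcal{V}$ and a family $\mathcal{E}$ of nonempty subsets of $\mathcal{V}$. A function $C:\mathcal{V}\to\{0,1,\dots,k\}$ is a conflict-free (CF) colouring of $H$ with $k$ non-zero colours if for every $e\in\mathcal{E}$ there is a non-zero colour $j$ with $|e\cap C^{ -1}(j)|=1$; $\chi_{cf}(H)$ is the minimum such $k$. For a function $t:\mathcal{E}\to\mathcal{V}$ with $t(e)\in e$ for all $e$ (a representative function), let $R=t(\mathcal{E})$ be its image; the co-occurrence graph $\Gamma_t$ is the simple graph with vertex set $R$ in which distinct $u,v\in R$ are adjacent if and only if there is some $e\in\mathcal{E}$ with $u\in e$, $v\in e$ and $t(e)\in\{u,v\}$. $\chi(\cdot)$ denotes the chromatic number. -}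

module Defs where

open import Data.Nat using (ℕ; zero; _<_; _≤_)
open import Data.Fin using (Fin)
open import Data.Fin.Subset using (Subset; _∈_; Nonempty)
open import Data.Product using (Σ; ∃; _×_)
open import Data.Sum using (_⊎_)
open import Relation.Binary.PropositionalEquality using (_≡_; _≢_)

record Hypergraph : Set where
  field
    n        : ℕ
    m        : ℕ
    edge     : Fin m → Subset n
    nonempty : (e : Fin m) → Nonempty (edge e)

open Hypergraph public

-- C : V → {0,…,k} (values ≤ k); 0 is the "uncoloured" colour.
IsCFColouring : (H : Hypergraph) (k : ℕ) → (Fin (n H) → ℕ) → Set
IsCFColouring H k C =
  ((v : Fin (n H)) → C v ≤ k) ×
  ((e : Fin (m H)) → Σ ℕ λ j → (j ≢ 0) × (j ≤ k) ×
      Σ (Fin (n H)) λ v → (v ∈ edge H e) × (C v ≡ j) ×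
        ((w : Fin (n H)) → w ∈ edge H e → C w ≡ j → w ≡ v))

CFColourable : Hypergraph → ℕ → Set
CFColourable H k = Σ (Fin (n H) → ℕ) (IsCFColouring H k)

IsCFChromaticNumber : Hypergraph → ℕ → Set
IsCFChromaticNumber H k = CFColourable H k × ((k' : ℕ) → CFColourable H k' → k ≤ k')

IsRepresentative : (H : Hypergraph) → (Fin (m H) → Fin (n H)) → Set
IsRepresentative H t = (e : Fin (m H)) → t e ∈ edge H e

record Graph (N : ℕ) : Set₁ where
  field
    Vertex : Fin N → Set
    Adj    : Fin N → Fin N → Set

open Graph public

InImage : (H : Hypergraph) → (Fin (m H) → Fin (n H)) → Fin (n H) → Set
InImage H t v = ∃ λ (e : Fin (m H)) → t e ≡ v

CoOccurrence : (H : Hypergraph) → (Fin (m H) → Fin (n H)) → Graph (n H)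
CoOccurrence H t = record
  { Vertex = InImage H t
  ; Adj    = λ u v → InImage H t u × InImage H t v × (u ≢ v) ×
               (∃ λ (e : Fin (m H)) → (u ∈ edge H e) × (v ∈ edge H e) × ((t e ≡ u) ⊎ (t e ≡ v)))
  }

-- Proper colouring with k colours {0,…,k-1} of the vertices of G (colours on non-vertices irrelevant).
Colourable : {N : ℕ} → Graph N → ℕ → Set
Colourable {N} G k = Σ (Fin N → ℕ) λ c →
  ((v : Fin N) → Vertex G v → c v < k) ×
  ((u v : Fin N) → Vertex G u → Vertex G v → Adj G u v → c u ≢ c v)

IsChromaticNumber : {N : ℕ} → Graph N → ℕ → Set
IsChromaticNumber G k = Colourable G k × ((k' : ℕ) → Colourable G k' → k ≤ k')

IsChiMin : Hypergraph → ℕ → Set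
IsChiMin H k =
  (Σ (Fin (m H) → Fin (n H)) λ t → IsRepresentative H t × IsChromaticNumber (CoOccurrence H t) k) ×
  ((t : Fin (m H) → Fin (n H)) → IsRepresentative H t →
     (j : ℕ) → IsChromaticNumber (CoOccurrence H t) j → k ≤ j)

-- The heart of the proof is that, for every k,
--   H has a CF colouring with k non-zero colours
--     ⇔  some representative t makes Γ_t properly k-colourable   (cf⇔co-occurrence).
-- (⇒) Let t(e) be the vertex whose colour is unique in e; the colours on R = t(E) are
--     non-zero, and shifting them down by one properly colours Γ_t, because an edge
--     joins t(e) only to vertices of e, none of which repeats the colour of t(e).
-- (⇐) Colour v ∈ R by 1 + (its colour in Γ_t) and every other vertex by 0; then t(e)
--     is uniquely coloured in e, since any other vertex of e with the same colour
--     would lie in R and be adjacent to t(e) in Γ_t.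
-- The theorem then follows from a purely order-theoretic fact (least⇔least-of-least):
-- if A(k) ⇔ ∃ t. Q_t(k), then the least k with A(k) is the minimum over t of the least
-- k with Q_t(k). Since least elements need not be computable, their existence is only
-- available under double negation (least-¬¬), which suffices because ≤ on ℕ is decidable.
module Submission where

open import Defs
open import Data.Nat using (ℕ; suc; pred; _<_; _≤_; _≤?_; z≤n; NonZero; ≢-nonZero)
open import Data.Nat.Properties using (≤-trans; ≮⇒≥; suc-injective; suc-pred; pred-injective)
open import Data.Nat.Induction using (<-rec)
open import Data.Fin using (Fin)
open import Data.Fin.Subset using (_∈_)
open import Data.Fin.Properties using (any?; _≟_)
open import Data.Product using (Σ; _×_; _,_; proj₂)
open import Data.Sum using (inj₁; inj₂)
open import Data.Empty using (⊥-elim)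
open import Relation.Nullary using (Dec; yes; no; ¬_)
open import Relation.Nullary.Decidable using (decidable-stable)
open import Relation.Binary.PropositionalEquality using (_≡_; _≢_; refl; sym; trans; subst)
open import Function.Bundles using (_⇔_; mk⇔; Equivalence)

IsLeast : (ℕ → Set) → ℕ → Set
IsLeast P k = P k × ((k' : ℕ) → P k' → k ≤ k')

-- Every inhabited predicate on ℕ has a least element, classically. By strong induction
-- on a witness b: b is least unless some smaller j satisfies P, and then use j instead.
least-¬¬ : (P : ℕ → Set) (b : ℕ) → P b → ¬ ¬ Σ ℕ (IsLeast P)
least-¬¬ P = <-rec (λ b → P b → ¬ ¬ Σ ℕ (IsLeast P)) step
  where
  step : ∀ b → (∀ {j} → j < b → P j → ¬ ¬ Σ ℕ (IsLeast P)) → P b → ¬ ¬ Σ ℕ (IsLeast P)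
  step b smaller pb noLeast =
    noLeast (b , pb , λ j pj → ≮⇒≥ (λ j<b → smaller j<b pj noLeast))

least⇔least-of-least : {T : Set} (Adm : T → Set) (Q : T → ℕ → Set) (A : ℕ → Set) →
  ((k : ℕ) → A k ⇔ Σ T λ t → Adm t × Q t k) →
  (k : ℕ) → IsLeast A k ⇔
    ((Σ T λ t → Adm t × IsLeast (Q t) k) ×
     ((t : T) → Adm t → (j : ℕ) → IsLeast (Q t) j → k ≤ j))
least⇔least-of-least {T} Adm Q A A⇔Q k = mk⇔ to from
  where
  toQ : ∀ {j} → A j → Σ T λ t → Adm t × Q t j
  toQ {j} = Equivalence.to (A⇔Q j)

  fromQ : ∀ {j} → (Σ T λ t → Adm t × Q t j) → A j
  fromQ {j} = Equivalence.from (A⇔Q j)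

  LeastOverT : Set
  LeastOverT = (Σ T λ t → Adm t × IsLeast (Q t) k) ×
               ((t : T) → Adm t → (j : ℕ) → IsLeast (Q t) j → k ≤ j)

  to : IsLeast A k → LeastOverT
  to (ak , kLeast) with toQ ak
  ... | t , adm , qk =
    (t , adm , qk , λ k' qk' → kLeast k' (fromQ (t , adm , qk'))) ,
    λ t' adm' j (qj , _) → kLeast j (fromQ (t' , adm' , qj))

  -- Lower bound: if A(k'), then Q_t(k') for some t whose least value j satisfies
  -- k ≤ j ≤ k'; the least j is only known to exist classically, but k ≤ k' is decidable.
  from : LeastOverT → IsLeast A k
  from ((t , adm , qk , _) , kMin) = fromQ (t , adm , qk) , lower
    where
    lower : (k' : ℕ) → A k' → k ≤ k'
    lower k' ak' with toQ ak'
    ... | t' , adm' , qk' = decidable-stable (k ≤? k') λ k≰k' →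
      least-¬¬ (Q t') k' qk' λ (j , jLeast) →
        k≰k' (≤-trans (kMin t' adm' j jLeast) (proj₂ jLeast k' qk'))

module _ (H : Hypergraph) where

  V : Set
  V = Fin (n H)

  E : Set
  E = Fin (m H)

  module FromCF {k : ℕ} (C : V → ℕ) (bounded : (v : V) → C v ≤ k)
                (cf : (e : E) → Σ ℕ λ j → (j ≢ 0) × (j ≤ k) ×
                   Σ V λ v → (v ∈ edge H e) × (C v ≡ j) ×
                     ((w : V) → w ∈ edge H e → C w ≡ j → w ≡ v)) where

    t : E → V
    t e = let (_ , _ , _ , v , _) = cf e in v

    t-representative : IsRepresentative H t
    t-representative e = let (_ , _ , _ , _ , v∈e , _) = cf e in v∈e

    t-unique : (e : E) (w : V) → w ∈ edge H e → C w ≡ C (t e) → w ≡ t e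
    t-unique e w w∈e Cw≡Ct = let (_ , _ , _ , _ , _ , Ct≡j , unique) = cf e in
      unique w w∈e (trans Cw≡Ct Ct≡j)

    image-nonzero : (v : V) → InImage H t v → NonZero (C v)
    image-nonzero v (e , refl) = let (_ , j≢0 , _ , _ , _ , Ct≡j , _) = cf e in
      ≢-nonZero λ Ct≡0 → j≢0 (trans (sym Ct≡j) Ct≡0)

    c : V → ℕ
    c v = pred (C v)

    c-bounded : (v : V) → InImage H t v → c v < k
    c-bounded v v∈R = subst (_≤ k) (sym (suc-pred (C v) {{image-nonzero v v∈R}})) (bounded v)

    -- Adjacent vertices of Γ_t share an edge with one of them its representative,
    -- so they have different C-colours.
    C-proper : (u v : V) → Adj (CoOccurrence H t) u v → C u ≢ C v
    C-proper u v (_ , _ , u≢v , e , u∈e , v∈e , inj₁ refl) Cu≡Cv =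
      u≢v (sym (t-unique e v v∈e (sym Cu≡Cv)))
    C-proper u v (_ , _ , u≢v , e , u∈e , v∈e , inj₂ refl) Cu≡Cv =
      u≢v (t-unique e u u∈e Cu≡Cv)

    c-proper : (u v : V) → InImage H t u → InImage H t v →
               Adj (CoOccurrence H t) u v → c u ≢ c v
    c-proper u v u∈R v∈R adj cu≡cv =
      C-proper u v adj (pred-injective {{image-nonzero u u∈R}} {{image-nonzero v v∈R}} cu≡cv)

  cf⇒co-occurrence : (k : ℕ) → CFColourable H k →
    Σ (E → V) λ t → IsRepresentative H t × Colourable (CoOccurrence H t) k
  cf⇒co-occurrence k (C , bounded , cf) =
    t , t-representative , c , c-bounded , c-proper
    where open FromCF C bounded cf

  shiftIf : {P : Set} → Dec P → ℕ → ℕ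
  shiftIf (yes _) x = suc x
  shiftIf (no _)  _ = 0

  shiftIf-yes : {P : Set} (d : Dec P) (x : ℕ) → P → shiftIf d x ≡ suc x
  shiftIf-yes (yes _) _ _ = refl
  shiftIf-yes (no ¬p) _ p = ⊥-elim (¬p p)

  shiftIf-suc : {P : Set} (d : Dec P) (x y : ℕ) → shiftIf d x ≡ suc y → P × x ≡ y
  shiftIf-suc (yes p) _ _ eq = p , suc-injective eq

  shiftIf-≤ : {P : Set} {k : ℕ} (d : Dec P) (x : ℕ) → (P → x < k) → shiftIf d x ≤ k
  shiftIf-≤ (yes p) _ x<k = x<k p
  shiftIf-≤ (no _)  _ _   = z≤n

  module ToCF {k : ℕ} (t : E → V) (t-representative : IsRepresentative H t)
              (c : V → ℕ) (c-bounded : (v : V) → InImage H t v → c v < k)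
              (c-proper : (u v : V) → InImage H t u → InImage H t v →
                          Adj (CoOccurrence H t) u v → c u ≢ c v) where

    inImage? : (v : V) → Dec (InImage H t v)
    inImage? v = any? (λ e → t e ≟ v)

    C : V → ℕ
    C v = shiftIf (inImage? v) (c v)

    C-bounded : (v : V) → C v ≤ k
    C-bounded v = shiftIf-≤ (inImage? v) (c v) (c-bounded v)

    t-coloured : (e : E) → C (t e) ≡ suc (c (t e))
    t-coloured e = shiftIf-yes (inImage? (t e)) (c (t e)) (e , refl)

    -- A vertex of e sharing t(e)'s colour lies in the image and has the same
    -- c-colour, so it cannot be adjacent to t(e) in Γ_t: it is t(e) itself.
    t-unique : (e : E) (w : V) → w ∈ edge H e → C w ≡ suc (c (t e)) → w ≡ t e
    t-unique e w w∈e Cw≡ with shiftIf-suc (inImage? w) (c w) (c (t e)) Cw≡ | w ≟ t e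
    ... | _        , _     | yes w≡t = w≡t
    ... | w∈R , cw≡ct | no  w≢t = ⊥-elim (c-proper w (t e) w∈R t∈R adj cw≡ct)
      where
      t∈R : InImage H t (t e)
      t∈R = e , refl
      adj : Adj (CoOccurrence H t) w (t e)
      adj = w∈R , t∈R , w≢t , e , w∈e , t-representative e , inj₂ refl

    conflict-free : IsCFColouring H k C
    conflict-free = C-bounded , λ e →
      suc (c (t e)) , (λ ()) , c-bounded (t e) (e , refl) ,
      t e , t-representative e , t-coloured e , t-unique e

  co-occurrence⇒cf : (k : ℕ) →
    (Σ (E → V) λ t → IsRepresentative H t × Colourable (CoOccurrence H t) k) →
    CFColourable H k
  co-occurrence⇒cf k (t , t-representative , c , c-bounded , c-proper) =
    C , conflict-free
    where open ToCF t t-representative c c-bounded c-proper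

  cf⇔co-occurrence : (k : ℕ) → CFColourable H k ⇔
    (Σ (E → V) λ t → IsRepresentative H t × Colourable (CoOccurrence H t) k)
  cf⇔co-occurrence k = mk⇔ (cf⇒co-occurrence k) (co-occurrence⇒cf k)

theorem4 : (H : Hypergraph) (k : ℕ) → IsCFChromaticNumber H k ⇔ IsChiMin H k
theorem4 H =
  least⇔least-of-least (IsRepresentative H) (λ t → Colourable (CoOccurrence H t))
    (CFColourable H) (cf⇔co-occurrence H)
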